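{- Let $G$ and $H$ be finite nonempty connected graphs each having at least one edge, $f\colon G\to H$ a graph homomorphism, $v\in V(G)$ and $w=f(v)$. Let $\alpha\in\pi_1^2(G,v)$ and $\varpi\in\Pi(f,v)$. Then $f_*(\alpha)\varpi=\varpi f_*(\alpha)$ in $\pi_1^2(H,w)$.
   Context: Graphs allow loops. $\pi_1^2(G,v)$: group (under concatenation) of classes of closed walks at $v$ under the equivalence relation generated by (A) $(x_0,\dots,x_m)\sim(x_0,\dots,x_k,y,x_k,\dots,x_m)$ with $y$ adjacent to $x_k$, and (B) walks of equal length with the same endpoints differing in at most one position; $f_*$ is induced by composition. $I_n$: vertices $0,\dots,n$, $i\sim j$ iff $|i-j|\le1$; $G\times I_n$ the categorical product ($(x,i)\sim(x',j)$ iff $x\sim x'$ and $i\sim j$). A $\times$-homotopy from $f$ to $f$ is a graph homomorphism $h\colon G\times I_n\to H$ with $h(x,0)=h(x,n)=f(x)$. For $v'$ adjacent to $v$, the class in $\pi_1^2(H,w)$ of the closed walk $(h(v,0),h(v',0),h(v,1),h(v',1),\dots,h(v',n-1),h(v,n))$ is independent of $v'$ and is said to be realized by $h$. $\Pi(f,v)$ is the subgroup of $\pi_1^2(H,w)$ of elements realized by some $\times$-homotopy from $f$ to $f$. -}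

module Defs where

open import Data.Nat using (ℕ; zero; suc; _≤_; _≥_)
open import Data.Fin using (Fin; toℕ; inject₁; fromℕ)
open import Data.List using (List; []; _∷_; _++_; map; drop; head; last; concatMap; [_])
open import Data.List.Relation.Unary.Linked using (Linked)
open import Data.Maybe using (just)
open import Data.Product using (Σ; ∃; _×_; _,_)
open import Data.Sum using (_⊎_)
open import Relation.Binary.PropositionalEquality using (_≡_)
open import Relation.Binary.Construct.Closure.Equivalence using (EqClosure)
open import Data.List using (allFin)
import Data.Fin

-- A finite (undirected, loops allowed) graph on vertex set Fin size.
record Graph : Set₁ where
  field
    size : ℕ
    _∼_  : Fin size → Fin size → Set
    ∼-sym : ∀ {x y} → x ∼ y → y ∼ x

open Graph public

V : Graph → Set
V G = Fin (size G)

Adj : (G : Graph) → V G → V G → Set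
Adj G = _∼_ G

IsWalk : (G : Graph) → List (V G) → Set
IsWalk G xs = Linked (Adj G) xs

IsWalkFromTo : (G : Graph) → V G → V G → List (V G) → Set
IsWalkFromTo G x y xs = IsWalk G xs × head xs ≡ just x × last xs ≡ just y

IsClosedWalk : (G : Graph) → V G → List (V G) → Set
IsClosedWalk G v xs = IsWalkFromTo G v v xs

Nonempty : Graph → Set
Nonempty G = size G ≥ 1

Connected : Graph → Set
Connected G = (x y : V G) → ∃ λ xs → IsWalkFromTo G x y xs

HasEdge : Graph → Set
HasEdge G = Σ (V G) λ x → Σ (V G) λ y → Adj G x y

IsHom : (G H : Graph) → (V G → V H) → Set
IsHom G H f = ∀ {x y} → Adj G x y → Adj H (f x) (f y)

data MoveA (G : Graph) : List (V G) → List (V G) → Set where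
  insertSpur : ∀ (p q : List (V G)) (x y : V G) → Adj G y x →
    MoveA G (p ++ x ∷ q) (p ++ x ∷ y ∷ x ∷ q)

data MoveB (G : Graph) : List (V G) → List (V G) → Set where
  changeOne : ∀ (p q : List (V G)) (a b : V G) →
    MoveB G (p ++ a ∷ q) (p ++ b ∷ q)

Step : (G : Graph) → V G → List (V G) → List (V G) → Set
Step G v xs ys = IsClosedWalk G v xs × IsClosedWalk G v ys × (MoveA G xs ys ⊎ MoveB G xs ys)

-- The equivalence relation defining π₁²(G,v): generated by the steps
-- among closed walks at v (equivalence closure of Step).
Homotopic : (G : Graph) → V G → List (V G) → List (V G) → Set
Homotopic G v = EqClosure (Step G v)

_·_ : ∀ {A : Set} → List A → List A → List A
xs · ys = xs ++ drop 1 ys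

push : ∀ {G H : Graph} → (V G → V H) → List (V G) → List (V H)
push f = map f

IAdj : ∀ n → Fin (suc n) → Fin (suc n) → Set
IAdj n i j = toℕ i ≤ suc (toℕ j) × toℕ j ≤ suc (toℕ i)

-- h : G × I_n → H is a graph homomorphism (categorical product)
IsProdHom : (G H : Graph) (n : ℕ) → (V G → Fin (suc n) → V H) → Set
IsProdHom G H n h = ∀ {x x' i j} → Adj G x x' → IAdj n i j → Adj H (h x i) (h x' j)

IsSelfHomotopy : (G H : Graph) (f : V G → V H) (n : ℕ) → (V G → Fin (suc n) → V H) → Set
IsSelfHomotopy G H f n h =
  IsProdHom G H n h × (∀ x → h x Data.Fin.zero ≡ f x) × (∀ x → h x (fromℕ n) ≡ f x)

realizedWalk : ∀ {G H : Graph} (n : ℕ) → (V G → Fin (suc n) → V H) → V G → V G → List (V H)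
realizedWalk n h v v' =
  concatMap (λ i → h v (inject₁ i) ∷ h v' (inject₁ i) ∷ []) (allFin n) ++ [ h v (fromℕ n) ]

-- ϖ (represented by a closed walk at f v) lies in Π(f,v): it is realized by
-- some ×-homotopy from f to f.
InΠ : (G H : Graph) (f : V G → V H) (v : V G) → List (V H) → Set
InΠ G H f v ϖ =
  Σ ℕ λ n → Σ (V G → Fin (suc n) → V H) λ h → IsSelfHomotopy G H f n h ×
    Σ (V G) λ v' → Adj G v v' × Homotopic H (f v) ϖ (realizedWalk {G} {H} n h v v')

-- Let h be a ×-homotopy from f to f realizing ϖ along the edge v v', and let R be the walk it
-- realizes.  R is a ladder (h₀ v, h₀ v', h₁ v, h₁ v', …, hₙ v) whose zigzags climb from one level
-- of h to the next.  Because each level hᵢ is a homomorphism and consecutive levels are adjacent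
-- along edges, the image hᵢ α can be pushed across one zigzag onto hᵢ₊₁ α by changing a single
-- vertex at a time (moves (B)).  Pushing it across all n zigzags turns h₀ α · R into R · hₙ α,
-- and h₀ = hₙ = f.
module Submission where

open import Defs
open import Data.Fin using (Fin; zero; suc; fromℕ; inject₁; _↑ˡ_)
open import Data.Fin.Properties using (toℕ-↑ˡ)
open import Data.List using (List; []; _∷_; _++_; _∷ʳ_; [_]; map; drop; head; concat)
open import Data.List.Properties using (++-assoc; ++-identityʳ; map-cong; map-tabulate)
open import Data.List.Relation.Unary.Linked using ([-]; _∷_)
open import Data.Maybe using (just)
open import Data.Nat using (zero; suc; _+_; z≤n; s≤s)
open import Data.Product using (_×_; _,_)
open import Data.Sum using (_⊎_; inj₁; inj₂)
open import Function using (id; flip; _∘_)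
open import Relation.Binary.Bundles using (Setoid)
open import Relation.Binary.PropositionalEquality using (_≡_; refl; sym; trans; cong; subst; subst₂)
open import Relation.Binary.Construct.Closure.Equivalence using (EqClosure; setoid; gmap; return)
open import Relation.Binary.Construct.Closure.ReflexiveTransitive using (_◅◅_)
import Relation.Binary.Reasoning.Setoid as SetoidReasoning

module _ {A : Set} where

  ·-identityʳ : ∀ (xs : List A) y → xs · [ y ] ≡ xs
  ·-identityʳ xs _ = ++-identityʳ xs

  ·-assoc : ∀ (xs : List A) {y} ys zs → head ys ≡ just y → (xs · ys) · zs ≡ xs · (ys · zs)
  ·-assoc xs (_ ∷ ys) zs _ = ++-assoc xs ys (drop 1 zs)

  ∷ʳ-· : ∀ (xs : List A) {y} ys → head ys ≡ just y → (xs ∷ʳ y) · ys ≡ xs ++ ys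
  ∷ʳ-· xs (_ ∷ ys) refl = ++-assoc xs [ _ ] ys

module _ {G : Graph} where

  edge-walk : ∀ {x y} → Adj G x y → IsWalkFromTo G x y (x ∷ y ∷ [])
  edge-walk x∼y = x∼y ∷ [-] , refl , refl

  path₂-walk : ∀ {x y z} → Adj G x y → Adj G y z → IsWalkFromTo G x z (x ∷ y ∷ z ∷ [])
  path₂-walk x∼y y∼z = x∼y ∷ y∼z ∷ [-] , refl , refl

  ∷-walk : ∀ {s x t xs} → Adj G s x → IsWalkFromTo G x t xs → IsWalkFromTo G s t (s ∷ xs)
  ∷-walk {xs = []}    _   (_ , () , _)
  ∷-walk {xs = _ ∷ _} s∼x (w , refl , l) = s∼x ∷ w , refl , l

  ·-walk : ∀ {s t u xs ys} → IsWalkFromTo G s t xs → IsWalkFromTo G t u ys → IsWalkFromTo G s u (xs · ys)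
  ·-walk {xs = []}                  (_ , () , _) _
  ·-walk {xs = _ ∷ []} {ys = []}    _ (_ , () , _)
  ·-walk {xs = _ ∷ []} {ys = _ ∷ _} (_ , refl , refl) (w , refl , l) = w , refl , l
  ·-walk {xs = _ ∷ _ ∷ _} (x∼x' ∷ w , refl , l) wys = ∷-walk x∼x' (·-walk (w , refl , l) wys)

map-walk : ∀ {G H f s t xs} → IsHom G H f → IsWalkFromTo G s t xs → IsWalkFromTo H (f s) (f t) (map f xs)
map-walk {xs = []}        _   (_ , () , _)
map-walk {xs = _ ∷ []}    _   (_ , refl , refl) = [-] , refl , refl
map-walk {G} {H} {xs = _ ∷ _ ∷ _} hom (x∼x' ∷ w , refl , l) =
  ∷-walk {H} (hom x∼x') (map-walk {G} {H} hom (w , refl , l))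

Move : (G : Graph) → List (V G) → List (V G) → Set
Move G xs ys = MoveA G xs ys ⊎ MoveB G xs ys

Move-∷ : ∀ {G xs ys} x → Move G xs ys → Move G (x ∷ xs) (x ∷ ys)
Move-∷ x (inj₁ (insertSpur p q y z y∼z)) = inj₁ (insertSpur (x ∷ p) q y z y∼z)
Move-∷ x (inj₂ (changeOne p q a b))      = inj₂ (changeOne (x ∷ p) q a b)

Move-++ʳ : ∀ {G xs ys} zs → Move G xs ys → Move G (xs ++ zs) (ys ++ zs)
Move-++ʳ {G} zs (inj₁ (insertSpur p q x y y∼x)) =
  inj₁ (subst₂ (MoveA G) (sym (++-assoc p (x ∷ q) zs)) (sym (++-assoc p (x ∷ y ∷ x ∷ q) zs))
    (insertSpur p (q ++ zs) x y y∼x))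
Move-++ʳ {G} zs (inj₂ (changeOne p q a b)) =
  inj₂ (subst₂ (MoveB G) (sym (++-assoc p (a ∷ q) zs)) (sym (++-assoc p (b ∷ q) zs))
    (changeOne p (q ++ zs) a b))

-- Homotopy of walks with fixed endpoints: Homotopic G v is literally HomotopicFromTo G v v.
OpenStep : (G : Graph) → V G → V G → List (V G) → List (V G) → Set
OpenStep G s t xs ys = IsWalkFromTo G s t xs × IsWalkFromTo G s t ys × Move G xs ys

HomotopicFromTo : (G : Graph) → V G → V G → List (V G) → List (V G) → Set
HomotopicFromTo G s t = EqClosure (OpenStep G s t)

module _ {H : Graph} where

  changeOne-homotopic : ∀ {s t} p q a b →
    IsWalkFromTo H s t (p ++ a ∷ q) → IsWalkFromTo H s t (p ++ b ∷ q) →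
    HomotopicFromTo H s t (p ++ a ∷ q) (p ++ b ∷ q)
  changeOne-homotopic p q a b wa wb = return (wa , wb , inj₂ (changeOne p q a b))

  ∷-step : ∀ {r s t xs ys} → Adj H r s → OpenStep H s t xs ys → OpenStep H r t (r ∷ xs) (r ∷ ys)
  ∷-step r∼s (wx , wy , m) = ∷-walk {H} r∼s wx , ∷-walk {H} r∼s wy , Move-∷ _ m

  ·-stepˡ : ∀ {r s t xs ys zs} → IsWalkFromTo H r s zs →
    OpenStep H s t xs ys → OpenStep H r t (zs · xs) (zs · ys)
  ·-stepˡ {zs = []} (_ , () , _) _
  ·-stepˡ {xs = []} _ ((_ , () , _) , _)
  ·-stepˡ {ys = []} _ (_ , (_ , () , _) , _)
  ·-stepˡ {xs = _ ∷ _} {_ ∷ _} {_ ∷ []} (_ , refl , refl) step@((_ , refl , _) , (_ , refl , _) , _) = step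
  ·-stepˡ {zs = _ ∷ _ ∷ _} (z∼z' ∷ w , refl , l) step = ∷-step z∼z' (·-stepˡ (w , refl , l) step)

  ·-congˡ : ∀ {r s t xs ys zs} → IsWalkFromTo H r s zs →
    HomotopicFromTo H s t xs ys → HomotopicFromTo H r t (zs · xs) (zs · ys)
  ·-congˡ {zs = zs} wz = gmap (zs ·_) (·-stepˡ wz)

  ·-congʳ : ∀ {s t u xs ys zs} → IsWalkFromTo H t u zs →
    HomotopicFromTo H s t xs ys → HomotopicFromTo H s u (xs · zs) (ys · zs)
  ·-congʳ {zs = zs} wz =
    gmap (_· zs) λ (wx , wy , m) → ·-walk {H} wx wz , ·-walk {H} wy wz , Move-++ʳ {H} (drop 1 zs) m

IAdj-1 : ∀ (i j : Fin 2) → IAdj 1 i j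
IAdj-1 zero       zero       = z≤n , z≤n
IAdj-1 zero       (suc zero) = z≤n , s≤s z≤n
IAdj-1 (suc zero) zero       = s≤s z≤n , z≤n
IAdj-1 (suc zero) (suc zero) = s≤s z≤n , s≤s z≤n

IAdj-↑ˡ : ∀ {m} n {i j : Fin (suc m)} → IAdj m i j → IAdj (m + n) (i ↑ˡ n) (j ↑ˡ n)
IAdj-↑ˡ n {i} {j} (i≤ , j≤) rewrite toℕ-↑ˡ i n | toℕ-↑ˡ j n = i≤ , j≤

module _ {G H : Graph} where

  IsProdHom-↑ˡ : ∀ {m n h} → IsProdHom G H (m + n) h → IsProdHom G H m (λ x i → h x (i ↑ˡ n))
  IsProdHom-↑ˡ {n = n} hom x∼y ij = hom x∼y (IAdj-↑ˡ n ij)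

  IsProdHom-suc : ∀ {n h} → IsProdHom G H (suc n) h → IsProdHom G H n (λ x i → h x (suc i))
  IsProdHom-suc hom x∼y (i≤ , j≤) = hom x∼y (s≤s i≤ , s≤s j≤)

  zigzag : ∀ {n} → (V G → Fin (suc (suc n)) → V H) → V G → V G → List (V H)
  zigzag h v v' = h v zero ∷ h v' zero ∷ h v (suc zero) ∷ []

  zigzag-walk : ∀ {n h v v'} → IsProdHom G H (suc n) h → Adj G v v' →
    IsWalkFromTo H (h v zero) (h v (suc zero)) (zigzag h v v')
  zigzag-walk hom v∼v' = path₂-walk {H} (hom v∼v' (z≤n , z≤n)) (hom (∼-sym G v∼v') (z≤n , s≤s z≤n))

  head-realizedWalk : ∀ n h v v' → head (realizedWalk {G} {H} n h v v') ≡ just (h v zero)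
  head-realizedWalk zero    _ _ _ = refl
  head-realizedWalk (suc _) _ _ _ = refl

  realizedWalk-suc : ∀ n h v v' →
    realizedWalk {G} {H} (suc n) h v v' ≡ zigzag h v v' · realizedWalk {G} {H} n (λ x i → h x (suc i)) v v'
  realizedWalk-suc n h v v' = trans
    (cong (λ rungs → h v zero ∷ h v' zero ∷ concat rungs ++ [ h v (fromℕ (suc n)) ])
      (trans (map-tabulate suc rung) (sym (map-tabulate id (rung ∘ suc)))))
    (sym (∷ʳ-· (h v zero ∷ h v' zero ∷ []) _ (head-realizedWalk n (λ x i → h x (suc i)) v v')))
    where
    rung : Fin (suc n) → List (V H)
    rung i = h v (inject₁ i) ∷ h v' (inject₁ i) ∷ []

  realizedWalk-walk : ∀ n {h v v'} → IsProdHom G H n h → Adj G v v' →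
    IsWalkFromTo H (h v zero) (h v (fromℕ n)) (realizedWalk {G} {H} n h v v')
  realizedWalk-walk zero _ _ = [-] , refl , refl
  realizedWalk-walk (suc n) {h} {v} {v'} hom v∼v' =
    subst (IsWalkFromTo H _ _) (sym (realizedWalk-suc n h v v'))
      (·-walk {H} (zigzag-walk {h = h} hom v∼v') (realizedWalk-walk n (IsProdHom-suc {h = h} hom) v∼v'))

  -- z' is left free because the induction takes it to be the previous vertex of level 1.
  slide : ∀ {h a t α z z'} → IsProdHom G H 1 h → IsWalkFromTo G a t α →
    IsWalkFromTo H (h t zero) (h t (suc zero)) (h t zero ∷ z ∷ h t (suc zero) ∷ []) →
    IsWalkFromTo H (h a zero) (h a (suc zero)) (h a zero ∷ z' ∷ h a (suc zero) ∷ []) →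
    HomotopicFromTo H (h a zero) (h t (suc zero))
      (map (flip h zero) α · (h t zero ∷ z ∷ h t (suc zero) ∷ []))
      ((h a zero ∷ z' ∷ h a (suc zero) ∷ []) · map (flip h (suc zero)) α)
  slide {α = []} _ (_ , () , _)
  slide {h} {α = a ∷ []} _ (_ , refl , refl) z-walk z'-walk =
    changeOne-homotopic [ h a zero ] [ h a (suc zero) ] _ _ z-walk z'-walk
  slide {h} {t = t} {α = a ∷ a₁ ∷ α} hom (a∼a₁ ∷ w , refl , l) z-walk z'-walk =
    ·-congˡ (edge-walk {H} (levels-adj zero zero a∼a₁)) (slide {h} hom (w , refl , l) z-walk rung-walk)
    ◅◅ changeOne-homotopic [ h a zero ] (map (flip h (suc zero)) (a ∷ a₁ ∷ α)) _ _
         (·-walk {H} corner-walk level₁-walk) (·-walk {H} z'-walk level₁-walk)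
    where
    levels-adj : ∀ i j {x y} → Adj G x y → Adj H (h x i) (h y j)
    levels-adj i j x∼y = hom x∼y (IAdj-1 i j)
    a₁∼a : Adj G a₁ a
    a₁∼a = ∼-sym G a∼a₁
    rung-walk : IsWalkFromTo H (h a₁ zero) (h a₁ (suc zero)) (h a₁ zero ∷ h a (suc zero) ∷ h a₁ (suc zero) ∷ [])
    rung-walk = path₂-walk {H} (levels-adj zero (suc zero) a₁∼a) (levels-adj (suc zero) (suc zero) a∼a₁)
    corner-walk : IsWalkFromTo H (h a zero) (h a (suc zero)) (h a zero ∷ h a₁ zero ∷ h a (suc zero) ∷ [])
    corner-walk = path₂-walk {H} (levels-adj zero zero a∼a₁) (levels-adj zero (suc zero) a₁∼a)
    level₁-walk : IsWalkFromTo H (h a (suc zero)) (h t (suc zero)) (map (flip h (suc zero)) (a ∷ a₁ ∷ α))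
    level₁-walk = map-walk {G} {H} (levels-adj (suc zero) (suc zero)) (a∼a₁ ∷ w , refl , l)

  realizedWalk-slide : ∀ n {h v v' α} → IsProdHom G H n h → Adj G v v' → IsWalkFromTo G v v α →
    HomotopicFromTo H (h v zero) (h v (fromℕ n))
      (map (flip h zero) α · realizedWalk {G} {H} n h v v')
      (realizedWalk {G} {H} n h v v' · map (flip h (fromℕ n)) α)
  realizedWalk-slide _ {α = []} _ _ (_ , () , _)
  realizedWalk-slide zero {h} {v} {α = _ ∷ _} _ _ (_ , refl , _) =
    Setoid.reflexive (setoid (OpenStep H (h v zero) (h v zero))) (·-identityʳ _ (h v zero))
  realizedWalk-slide (suc n) {h} {v} {v'} {α@(_ ∷ _)} hom v∼v' α-walk = begin
      map h₀ α · R
    ≡⟨ cong (map h₀ α ·_) (realizedWalk-suc n h v v') ⟩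
      map h₀ α · (Z · R')
    ≡⟨ ·-assoc (map h₀ α) Z R' refl ⟨
      (map h₀ α · Z) · R'
    ≈⟨ ·-congʳ (realizedWalk-walk n hom' v∼v') (slide (IsProdHom-↑ˡ hom) α-walk Z-walk Z-walk) ⟩
      (Z · map h₁ α) · R'
    ≡⟨ ·-assoc Z (map h₁ α) R' refl ⟩
      Z · (map h₁ α · R')
    ≈⟨ ·-congˡ Z-walk (realizedWalk-slide n hom' v∼v' α-walk) ⟩
      Z · (R' · map hₙ α)
    ≡⟨ ·-assoc Z R' (map hₙ α) (head-realizedWalk n (λ x i → h x (suc i)) v v') ⟨
      (Z · R') · map hₙ α
    ≡⟨ cong (_· map hₙ α) (realizedWalk-suc n h v v') ⟨
      R · map hₙ α ∎
    where
    open SetoidReasoning (setoid (OpenStep H (h v zero) (h v (fromℕ (suc n)))))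
    h₀ = flip h zero
    h₁ = flip h (suc zero)
    hₙ = flip h (fromℕ (suc n))
    hom' = IsProdHom-suc hom
    R = realizedWalk {G} {H} (suc n) h v v'
    R' = realizedWalk {G} {H} n (λ x i → h x (suc i)) v v'
    Z = zigzag h v v'
    Z-walk = zigzag-walk hom v∼v'

-- The finiteness, nonemptiness, connectivity and edge hypotheses, and the closedness of ϖ, only
-- make π₁² and Π(f,v) meaningful; the argument does not need them.
corollary5p2 : (G H : Graph) →
    Nonempty G → Connected G → HasEdge G →
    Nonempty H → Connected H → HasEdge H →
    (f : V G → V H) → IsHom G H f →
    (v : V G) →
    (α : List (V G)) → IsClosedWalk G v α →
    (ϖ : List (V H)) → IsClosedWalk H (f v) ϖ → InΠ G H f v ϖ →
    Homotopic H (f v) (push {G} {H} f α · ϖ) (ϖ · push {G} {H} f α)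
corollary5p2 G H _ _ _ _ _ _ f f-hom v α α-closed ϖ _ (n , h , (hom , h₀≡f , hₙ≡f) , v' , v∼v' , ϖ∼R) = begin
    map f α · ϖ
  ≈⟨ ·-congˡ fα-closed ϖ∼R ⟩
    map f α · R
  ≡⟨ cong (_· R) (map-cong {f = flip h zero} h₀≡f α) ⟨
    map (flip h zero) α · R
  ≈⟨ subst₂ (λ s t → HomotopicFromTo H s t (map (flip h zero) α · R) (R · map (flip h (fromℕ n)) α))
      (h₀≡f v) (hₙ≡f v) (realizedWalk-slide {G} {H} n {h} {v} {v'} {α} hom v∼v' α-closed) ⟩
    R · map (flip h (fromℕ n)) α
  ≡⟨ cong (R ·_) (map-cong {f = flip h (fromℕ n)} hₙ≡f α) ⟩
    R · map f α
  ≈⟨ ·-congʳ fα-closed ϖ∼R ⟨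
    ϖ · map f α ∎
  where
  open SetoidReasoning (setoid (Step H (f v)))
  R = realizedWalk {G} {H} n h v v'
  fα-closed = map-walk {G} {H} f-hom α-closed
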